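{- Let $p$ be an odd prime, let $A = (p^2-1)/4$, let $b_p(t_1,t_2) \in \mathbb{F}_p[t_1,t_2]$ be the coefficient of $x^{2A}$ in $(x-1)^{2A}(x-t_1)^A(x-t_2)^A$, and let $B(t) = b_p(t,-t) \in \mathbb{F}_p[t]$. Then $B(t)$ is an even polynomial of degree $(p^2-1)/2$ with non-zero constant term, and the coefficient of $t^2$ in $B(t)$ is congruent to $3/32$ modulo $p$. -}

module Defs where

open import Data.Nat using (ℕ; zero; suc; _∸_; _/_)
import Data.Nat as ℕ
open import Data.Integer using (ℤ) renaming (_+_ to _+ℤ_; _*_ to _*ℤ_; -_ to -ℤ_; _-_ to _-ℤ_)
import Data.Integer as ℤ
open import Data.Integer.Divisibility using (_∣_)
open import Data.List using (List; []; _∷_; map)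

record RawR (A : Set) : Set where
  field
    0# 1# : A
    _+_ _*_ : A → A → A
    -_ : A → A

-- Univariate polynomials as coefficient lists, lowest degree first.
Poly : Set → Set
Poly A = List A

module PolyOps {A : Set} (R : RawR A) where
  open RawR R

  padd : Poly A → Poly A → Poly A
  padd [] q = q
  padd (a ∷ p) [] = a ∷ p
  padd (a ∷ p) (b ∷ q) = (a + b) ∷ padd p q

  pneg : Poly A → Poly A
  pneg = map -_

  pmul : Poly A → Poly A → Poly A
  pmul [] q = []
  pmul (a ∷ p) q = padd (map (a *_) q) (0# ∷ pmul p q)

  pconst : A → Poly A
  pconst a = a ∷ []

  pX : Poly A
  pX = 0# ∷ 1# ∷ []

  coeff : Poly A → ℕ → A
  coeff [] _ = 0#
  coeff (a ∷ p) zero = a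
  coeff (a ∷ p) (suc n) = coeff p n

  polyR : RawR (Poly A)
  polyR = record { 0# = [] ; 1# = pconst 1# ; _+_ = padd ; _*_ = pmul ; -_ = pneg }

  evalAt : {S : Set} → RawR S → (A → S) → Poly A → S → S
  evalAt S f [] s = RawR.0# S
  evalAt S f (a ∷ p) s = RawR._+_ S (f a) (RawR._*_ S s (evalAt S f p s))

powR : {A : Set} → RawR A → A → ℕ → A
powR R a zero = RawR.1# R
powR R a (suc n) = RawR._*_ R a (powR R a n)

ℤR : RawR ℤ
ℤR = record { 0# = ℤ.0ℤ ; 1# = ℤ.1ℤ ; _+_ = _+ℤ_ ; _*_ = _*ℤ_ ; -_ = -ℤ_ }

-- ℤ[t₂], ℤ[t₂][t₁], ℤ[t₂][t₁][x]
P1R : RawR (Poly ℤ)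
P1R = PolyOps.polyR ℤR

P2R : RawR (Poly (Poly ℤ))
P2R = PolyOps.polyR P1R

P3R : RawR (Poly (Poly (Poly ℤ)))
P3R = PolyOps.polyR P2R

module O1 = PolyOps ℤR
module O2 = PolyOps P1R
module O3 = PolyOps P2R

Aₚ : ℕ → ℕ
Aₚ p = (p ℕ.* p ∸ 1) / 4

X₃ T₁ T₂ One₃ : Poly (Poly (Poly ℤ))
X₃ = O3.pX
T₁ = O3.pconst O2.pX
T₂ = O3.pconst (O2.pconst O1.pX)
One₃ = RawR.1# P3R

-- b_p(t₁,t₂) (integer lift): coefficient of x^{2A} in (x-1)^{2A}(x-t₁)^A(x-t₂)^A
bₚ : ℕ → Poly (Poly ℤ)
bₚ p = O3.coeff
  (O3.pmul (powR P3R (O3.padd X₃ (O3.pneg One₃)) (2 ℕ.* Aₚ p))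
    (O3.pmul (powR P3R (O3.padd X₃ (O3.pneg T₁)) (Aₚ p))
             (powR P3R (O3.padd X₃ (O3.pneg T₂)) (Aₚ p))))
  (2 ℕ.* Aₚ p)

-- B(t) = b_p(t, -t) ∈ ℤ[t]
Bₚ : ℕ → Poly ℤ
Bₚ p = O2.evalAt P1R inner (bₚ p) O1.pX
  where
  inner : Poly ℤ → Poly ℤ
  inner c = O1.evalAt P1R O1.pconst c (O1.pneg O1.pX)

Bcoeff : ℕ → ℕ → ℤ
Bcoeff p n = O1.coeff (Bₚ p) n

-- congruence modulo p in ℤ (equality in 𝔽ₚ of the reductions)
infix 4 _≡_[mod_]
_≡_[mod_] : ℤ → ℤ → ℕ → Set
a ≡ b [mod p ] = ℤ.+ p ∣ (a -ℤ b)

-- Under t₁ ↦ t, t₂ ↦ -t the factor (x - t₁)^A (x - t₂)^A becomes (x² - t²)^A, so B is the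
-- x^(2A)-coefficient of (x - 1)^(2A) (x² - t²)^A.  The second factor is homogeneous of degree 2A
-- in (x, t) and even in t, so only one term of the Cauchy product contributes to the coefficient
-- of tᵏ in B, namely [xᵏ] (x - 1)^(2A) · [x^(2A-k) tᵏ] (x² - t²)^A.  Hence the odd coefficients
-- and those beyond 2A vanish, the top one is (-1)^A, the constant one is 1, and the coefficient
-- of t² is A(2A - 1) · (-A).  All of this holds over ℤ; reducing modulo p, where 4A = p² - 1
-- makes A = -1/4, turns -A²(2A - 1) into 3/32.

module Submission where

open import Defs
open import Data.Nat using (ℕ; _∸_; _/_; _<_)
import Data.Nat as ℕ
open import Data.Integer using (ℤ; +_)
import Data.Integer as ℤ
open import Data.Nat.Primality using (Prime)
open import Data.Product using (_×_)
open import Relation.Binary.PropositionalEquality using (_≢_)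
open import Relation.Nullary using (¬_)

open import Level using (0ℓ)
open import Data.Empty using (⊥-elim)
open import Data.Nat using (zero; suc; _≤_)
import Data.Nat.Properties as ℕₚ
open import Data.Nat.Primality using (¬prime[1]; prime⇒irreducible)
open import Data.Nat.Divisibility using (divides; ∣1⇒≡1)
open import Data.Nat.DivMod using (m*n/n≡m)
import Data.Nat.Tactic.RingSolver as NS
open import Data.Integer using (-1ℤ)
import Data.Integer.Properties as ℤₚ
open import Data.Integer.Tactic.RingSolver using (solve-∀)
open import Data.List using ([]; _∷_; map)
open import Data.Product using (_,_; ∃-syntax)
open import Data.Sum using (_⊎_; inj₁; inj₂)
open import Algebra.Bundles using (CommutativeRing)
open import Algebra.Structures using (IsCommutativeRing)
open import Algebra.Morphism.Structures using (IsRingHomomorphism)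

-- Polynomials over a commutative ring

toRawR : ∀ {ℓ} (R : CommutativeRing 0ℓ ℓ) → RawR (CommutativeRing.Carrier R)
toRawR R = record { 0# = 0# ; 1# = 1# ; _+_ = _+_ ; _*_ = _*_ ; -_ = -_ }
  where open CommutativeRing R

module _ {ℓ₁ ℓ₂} (R : CommutativeRing 0ℓ ℓ₁) (S : CommutativeRing 0ℓ ℓ₂) where
  private
    module R = CommutativeRing R
    module S = CommutativeRing S

  isRingHomomorphism : {f : R.Carrier → S.Carrier} →
    (∀ {x y} → x R.≈ y → f x S.≈ f y) →
    (∀ x y → f (x R.+ y) S.≈ f x S.+ f y) → (∀ x y → f (x R.* y) S.≈ f x S.* f y) →
    (∀ x → f (R.- x) S.≈ S.- f x) → f R.0# S.≈ S.0# → f R.1# S.≈ S.1# →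
    IsRingHomomorphism R.rawRing S.rawRing f
  isRingHomomorphism cong +-homo *-homo -‿homo 0#-homo 1#-homo = record
    { isSemiringHomomorphism = record
      { isNearSemiringHomomorphism = record
        { +-isMonoidHomomorphism = record
          { isMagmaHomomorphism = record { isRelHomomorphism = record { cong = cong } ; homo = +-homo }
          ; ε-homo = 0#-homo }
        ; *-homo = *-homo }
      ; 1#-homo = 1#-homo }
    ; -‿homo = -‿homo }

module Polynomial {ℓ} (R : CommutativeRing 0ℓ ℓ) where
  open CommutativeRing R hiding (zero; isCommutativeRing) renaming (Carrier to C)
  open PolyOps (toRawR R)
  open import Algebra.Properties.Ring ring using (-0#≈0#)
  open import Algebra.Properties.CommutativeSemigroup +-commutativeSemigroup
    using (interchange; x∙yz≈y∙xz)
  open import Relation.Binary.Reasoning.Setoid setoid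

  infix 4 _≈ᴾ_
  record _≈ᴾ_ (p q : Poly C) : Set ℓ where
    constructor coeffwise
    field at : ∀ n → coeff p n ≈ coeff q n
  open _≈ᴾ_ public

  ≈ᴾ-refl : ∀ {p} → p ≈ᴾ p
  ≈ᴾ-refl .at n = refl

  ≈ᴾ-sym : ∀ {p q} → p ≈ᴾ q → q ≈ᴾ p
  ≈ᴾ-sym e .at n = sym (e .at n)

  ≈ᴾ-trans : ∀ {p q r} → p ≈ᴾ q → q ≈ᴾ r → p ≈ᴾ r
  ≈ᴾ-trans e f .at n = trans (e .at n) (f .at n)

  shift : Poly C → Poly C
  shift p = 0# ∷ p

  shift-cong : ∀ {p q} → p ≈ᴾ q → shift p ≈ᴾ shift q
  shift-cong e .at zero = refl
  shift-cong e .at (suc n) = e .at n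

  coeff-[0#] : ∀ n → coeff (0# ∷ []) n ≈ 0#
  coeff-[0#] zero = refl
  coeff-[0#] (suc n) = refl

  coeff-padd : ∀ p q n → coeff (padd p q) n ≈ coeff p n + coeff q n
  coeff-padd [] q n = sym (+-identityˡ _)
  coeff-padd (a ∷ p) [] zero = sym (+-identityʳ _)
  coeff-padd (a ∷ p) [] (suc n) = sym (+-identityʳ _)
  coeff-padd (a ∷ p) (b ∷ q) zero = refl
  coeff-padd (a ∷ p) (b ∷ q) (suc n) = coeff-padd p q n

  coeff-map : (f : C → C) → f 0# ≈ 0# → ∀ p n → coeff (map f p) n ≈ f (coeff p n)
  coeff-map f f0 [] n = sym f0
  coeff-map f f0 (a ∷ p) zero = refl
  coeff-map f f0 (a ∷ p) (suc n) = coeff-map f f0 p n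

  coeff-scale : ∀ a p n → coeff (map (a *_) p) n ≈ a * coeff p n
  coeff-scale a = coeff-map (a *_) (zeroʳ a)

  coeff-pneg : ∀ p n → coeff (pneg p) n ≈ - coeff p n
  coeff-pneg = coeff-map -_ -0#≈0#

  coeff-shift-padd : ∀ p q n → coeff (shift (padd p q)) n ≈ coeff (shift p) n + coeff (shift q) n
  coeff-shift-padd p q zero = sym (+-identityˡ 0#)
  coeff-shift-padd p q (suc n) = coeff-padd p q n

  coeff-shift-scale : ∀ a p n → coeff (shift (map (a *_) p)) n ≈ a * coeff (shift p) n
  coeff-shift-scale a p zero = sym (zeroʳ a)
  coeff-shift-scale a p (suc n) = coeff-scale a p n

  coeff-pmul-∷ : ∀ a p q n → coeff (pmul (a ∷ p) q) n ≈ a * coeff q n + coeff (shift (pmul p q)) n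
  coeff-pmul-∷ a p q n = trans (coeff-padd (map (a *_) q) (shift (pmul p q)) n) (+-cong (coeff-scale a q n) refl)

  padd-cong : ∀ {p p′ q q′} → p ≈ᴾ p′ → q ≈ᴾ q′ → padd p q ≈ᴾ padd p′ q′
  padd-cong {p} {p′} {q} {q′} e f .at n = begin
    coeff (padd p q) n         ≈⟨ coeff-padd p q n ⟩
    coeff p n + coeff q n      ≈⟨ +-cong (e .at n) (f .at n) ⟩
    coeff p′ n + coeff q′ n    ≈⟨ coeff-padd p′ q′ n ⟨
    coeff (padd p′ q′) n       ∎

  pneg-cong : ∀ {p q} → p ≈ᴾ q → pneg p ≈ᴾ pneg q
  pneg-cong {p} {q} e .at n = trans (coeff-pneg p n) (trans (-‿cong (e .at n)) (sym (coeff-pneg q n)))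

  padd-comm : ∀ p q → padd p q ≈ᴾ padd q p
  padd-comm p q .at n = trans (coeff-padd p q n) (trans (+-comm _ _) (sym (coeff-padd q p n)))

  padd-assoc : ∀ p q r → padd (padd p q) r ≈ᴾ padd p (padd q r)
  padd-assoc p q r .at n = begin
    coeff (padd (padd p q) r) n              ≈⟨ coeff-padd (padd p q) r n ⟩
    coeff (padd p q) n + coeff r n           ≈⟨ +-cong (coeff-padd p q n) refl ⟩
    (coeff p n + coeff q n) + coeff r n      ≈⟨ +-assoc _ _ _ ⟩
    coeff p n + (coeff q n + coeff r n)      ≈⟨ +-cong refl (coeff-padd q r n) ⟨
    coeff p n + coeff (padd q r) n           ≈⟨ coeff-padd p (padd q r) n ⟨
    coeff (padd p (padd q r)) n              ∎

  padd-identityʳ : ∀ p → padd p [] ≈ᴾ p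
  padd-identityʳ p .at n = trans (coeff-padd p [] n) (+-identityʳ _)

  pneg-inverseˡ : ∀ p → padd (pneg p) p ≈ᴾ []
  pneg-inverseˡ p .at n = trans (coeff-padd (pneg p) p n) (trans (+-cong (coeff-pneg p n) refl) (-‿inverseˡ _))

  pneg-inverseʳ : ∀ p → padd p (pneg p) ≈ᴾ []
  pneg-inverseʳ p .at n = trans (coeff-padd p (pneg p) n) (trans (+-cong refl (coeff-pneg p n)) (-‿inverseʳ _))

  pmul-zeroʳ : ∀ p → pmul p [] ≈ᴾ []
  pmul-zeroʳ [] .at n = refl
  pmul-zeroʳ (a ∷ p) .at zero = refl
  pmul-zeroʳ (a ∷ p) .at (suc n) = pmul-zeroʳ p .at n

  pmul-congʳ : ∀ p {q q′} → q ≈ᴾ q′ → pmul p q ≈ᴾ pmul p q′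
  pmul-congʳ [] e .at n = refl
  pmul-congʳ (a ∷ p) {q} {q′} e .at n = begin
    coeff (pmul (a ∷ p) q) n                              ≈⟨ coeff-pmul-∷ a p q n ⟩
    a * coeff q n + coeff (shift (pmul p q)) n            ≈⟨ +-cong (*-cong refl (e .at n)) (shift-cong (pmul-congʳ p e) .at n) ⟩
    a * coeff q′ n + coeff (shift (pmul p q′)) n          ≈⟨ coeff-pmul-∷ a p q′ n ⟨
    coeff (pmul (a ∷ p) q′) n                             ∎

  pmul-∷ʳ : ∀ q a p → pmul q (a ∷ p) ≈ᴾ padd (map (a *_) q) (shift (pmul q p))
  pmul-∷ʳ [] a p .at zero = refl
  pmul-∷ʳ [] a p .at (suc n) = refl
  pmul-∷ʳ (b ∷ q) a p .at zero = +-cong (*-comm b a) refl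
  pmul-∷ʳ (b ∷ q) a p .at (suc n) = begin
    coeff (padd (map (b *_) p) (pmul q (a ∷ p))) n
      ≈⟨ coeff-padd (map (b *_) p) (pmul q (a ∷ p)) n ⟩
    coeff (map (b *_) p) n + coeff (pmul q (a ∷ p)) n
      ≈⟨ +-cong (coeff-scale b p n) (pmul-∷ʳ q a p .at n) ⟩
    b * coeff p n + coeff (padd (map (a *_) q) (shift (pmul q p))) n
      ≈⟨ +-cong refl (coeff-padd (map (a *_) q) (shift (pmul q p)) n) ⟩
    b * coeff p n + (coeff (map (a *_) q) n + coeff (shift (pmul q p)) n)
      ≈⟨ x∙yz≈y∙xz _ _ _ ⟩
    coeff (map (a *_) q) n + (b * coeff p n + coeff (shift (pmul q p)) n)
      ≈⟨ +-cong refl (coeff-pmul-∷ b q p n) ⟨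
    coeff (map (a *_) q) n + coeff (pmul (b ∷ q) p) n
      ≈⟨ coeff-padd (map (a *_) q) (pmul (b ∷ q) p) n ⟨
    coeff (padd (map (a *_) q) (pmul (b ∷ q) p)) n
      ∎

  pmul-comm : ∀ p q → pmul p q ≈ᴾ pmul q p
  pmul-comm [] q = ≈ᴾ-sym (pmul-zeroʳ q)
  pmul-comm (a ∷ p) q = ≈ᴾ-trans (padd-cong ≈ᴾ-refl (shift-cong (pmul-comm p q))) (≈ᴾ-sym (pmul-∷ʳ q a p))

  pmul-congˡ : ∀ {p p′} q → p ≈ᴾ p′ → pmul p q ≈ᴾ pmul p′ q
  pmul-congˡ {p} {p′} q e = ≈ᴾ-trans (pmul-comm p q) (≈ᴾ-trans (pmul-congʳ q e) (pmul-comm q p′))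

  pmul-cong : ∀ {p p′ q q′} → p ≈ᴾ p′ → q ≈ᴾ q′ → pmul p q ≈ᴾ pmul p′ q′
  pmul-cong {p′ = p′} {q = q} e f = ≈ᴾ-trans (pmul-congˡ q e) (pmul-congʳ p′ f)

  pmul-distribˡ-padd : ∀ p q r → pmul p (padd q r) ≈ᴾ padd (pmul p q) (pmul p r)
  pmul-distribˡ-padd [] q r .at n = refl
  pmul-distribˡ-padd (a ∷ p) q r .at n = begin
    coeff (pmul (a ∷ p) (padd q r)) n
      ≈⟨ coeff-pmul-∷ a p (padd q r) n ⟩
    a * coeff (padd q r) n + coeff (shift (pmul p (padd q r))) n
      ≈⟨ +-cong (*-cong refl (coeff-padd q r n)) (shift-cong (pmul-distribˡ-padd p q r) .at n) ⟩
    a * (coeff q n + coeff r n) + coeff (shift (padd (pmul p q) (pmul p r))) n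
      ≈⟨ +-cong (distribˡ _ _ _) (coeff-shift-padd (pmul p q) (pmul p r) n) ⟩
    (a * coeff q n + a * coeff r n) + (coeff (shift (pmul p q)) n + coeff (shift (pmul p r)) n)
      ≈⟨ interchange _ _ _ _ ⟩
    (a * coeff q n + coeff (shift (pmul p q)) n) + (a * coeff r n + coeff (shift (pmul p r)) n)
      ≈⟨ +-cong (coeff-pmul-∷ a p q n) (coeff-pmul-∷ a p r n) ⟨
    coeff (pmul (a ∷ p) q) n + coeff (pmul (a ∷ p) r) n
      ≈⟨ coeff-padd (pmul (a ∷ p) q) (pmul (a ∷ p) r) n ⟨
    coeff (padd (pmul (a ∷ p) q) (pmul (a ∷ p) r)) n
      ∎

  pmul-distribʳ-padd : ∀ r p q → pmul (padd p q) r ≈ᴾ padd (pmul p r) (pmul q r)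
  pmul-distribʳ-padd r p q =
    ≈ᴾ-trans (pmul-comm (padd p q) r)
      (≈ᴾ-trans (pmul-distribˡ-padd r p q) (padd-cong (pmul-comm r p) (pmul-comm r q)))

  pmul-scaleˡ : ∀ a q r → pmul (map (a *_) q) r ≈ᴾ map (a *_) (pmul q r)
  pmul-scaleˡ a [] r .at n = refl
  pmul-scaleˡ a (b ∷ q) r .at n = begin
    coeff (pmul ((a * b) ∷ map (a *_) q) r) n
      ≈⟨ coeff-pmul-∷ (a * b) (map (a *_) q) r n ⟩
    (a * b) * coeff r n + coeff (shift (pmul (map (a *_) q) r)) n
      ≈⟨ +-cong (*-assoc _ _ _) (shift-cong (pmul-scaleˡ a q r) .at n) ⟩
    a * (b * coeff r n) + coeff (shift (map (a *_) (pmul q r))) n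
      ≈⟨ +-cong refl (coeff-shift-scale a (pmul q r) n) ⟩
    a * (b * coeff r n) + a * coeff (shift (pmul q r)) n
      ≈⟨ distribˡ _ _ _ ⟨
    a * (b * coeff r n + coeff (shift (pmul q r)) n)
      ≈⟨ *-cong refl (coeff-pmul-∷ b q r n) ⟨
    a * coeff (pmul (b ∷ q) r) n
      ≈⟨ coeff-scale a (pmul (b ∷ q) r) n ⟨
    coeff (map (a *_) (pmul (b ∷ q) r)) n
      ∎

  pmul-shiftˡ : ∀ p r → pmul (shift p) r ≈ᴾ shift (pmul p r)
  pmul-shiftˡ p r .at n = trans (coeff-pmul-∷ 0# p r n) (trans (+-cong (zeroˡ _) refl) (+-identityˡ _))

  pmul-assoc : ∀ p q r → pmul (pmul p q) r ≈ᴾ pmul p (pmul q r)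
  pmul-assoc [] q r .at n = refl
  pmul-assoc (a ∷ p) q r =
    ≈ᴾ-trans (pmul-distribʳ-padd r (map (a *_) q) (shift (pmul p q)))
      (padd-cong (pmul-scaleˡ a q r)
        (≈ᴾ-trans (pmul-shiftˡ (pmul p q) r) (shift-cong (pmul-assoc p q r))))

  pmul-pconstˡ : ∀ a q → pmul (pconst a) q ≈ᴾ map (a *_) q
  pmul-pconstˡ a q .at n = begin
    coeff (pmul (pconst a) q) n                  ≈⟨ coeff-pmul-∷ a [] q n ⟩
    a * coeff q n + coeff (0# ∷ []) n            ≈⟨ +-cong refl (coeff-[0#] n) ⟩
    a * coeff q n + 0#                           ≈⟨ +-identityʳ _ ⟩
    a * coeff q n                                ≈⟨ coeff-scale a q n ⟨
    coeff (map (a *_) q) n                       ∎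

  pmul-identityˡ : ∀ q → pmul (pconst 1#) q ≈ᴾ q
  pmul-identityˡ q .at n = trans (pmul-pconstˡ 1# q .at n) (trans (coeff-scale 1# q n) (*-identityˡ _))

  pmul-pXˡ : ∀ q → pmul pX q ≈ᴾ shift q
  pmul-pXˡ q = ≈ᴾ-trans (pmul-shiftˡ (pconst 1#) q) (shift-cong (pmul-identityˡ q))

  isCommutativeRing : IsCommutativeRing _≈ᴾ_ padd pmul pneg [] (pconst 1#)
  isCommutativeRing = record
    { isRing = record
      { +-isAbelianGroup = record
        { isGroup = record
          { isMonoid = record
            { isSemigroup = record
              { isMagma = record
                { isEquivalence = record { refl = ≈ᴾ-refl ; sym = ≈ᴾ-sym ; trans = ≈ᴾ-trans }
                ; ∙-cong = padd-cong }
              ; assoc = padd-assoc }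
            ; identity = (λ p → ≈ᴾ-refl) , padd-identityʳ }
          ; inverse = pneg-inverseˡ , pneg-inverseʳ
          ; ⁻¹-cong = pneg-cong }
        ; comm = padd-comm }
      ; *-cong = pmul-cong
      ; *-assoc = pmul-assoc
      ; *-identity = pmul-identityˡ , (λ q → ≈ᴾ-trans (pmul-comm q (pconst 1#)) (pmul-identityˡ q))
      ; distrib = pmul-distribˡ-padd , pmul-distribʳ-padd }
    ; *-comm = pmul-comm }

  commutativeRing : CommutativeRing 0ℓ ℓ
  commutativeRing = record { isCommutativeRing = isCommutativeRing }

  convolution : (ℕ → C) → (ℕ → C) → ℕ → C
  convolution P Q zero = P 0 * Q 0
  convolution P Q (suc n) = P 0 * Q (suc n) + convolution (λ i → P (suc i)) Q n

  convolution-cong : ∀ {P P′ Q Q′} → (∀ i → P i ≈ P′ i) → (∀ i → Q i ≈ Q′ i) →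
                     ∀ n → convolution P Q n ≈ convolution P′ Q′ n
  convolution-cong e f zero = *-cong (e 0) (f 0)
  convolution-cong e f (suc n) = +-cong (*-cong (e 0) (f (suc n))) (convolution-cong (λ i → e (suc i)) f n)

  convolution-vanishes : ∀ P Q n → (∀ b → b ≤ n → Q b ≈ 0#) → convolution P Q n ≈ 0#
  convolution-vanishes P Q zero z = trans (*-cong refl (z 0 ℕ.z≤n)) (zeroʳ _)
  convolution-vanishes P Q (suc n) z = begin
    P 0 * Q (suc n) + convolution (λ i → P (suc i)) Q n
      ≈⟨ +-cong (*-cong refl (z (suc n) ℕₚ.≤-refl))
                (convolution-vanishes _ Q n (λ b b≤n → z b (ℕₚ.m≤n⇒m≤1+n b≤n))) ⟩
    P 0 * 0# + 0#  ≈⟨ +-identityʳ _ ⟩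
    P 0 * 0#       ≈⟨ zeroʳ _ ⟩
    0#             ∎

  convolution-single : ∀ d P Q m → (∀ b → b ≢ m → Q b ≈ 0#) → convolution P Q (d ℕ.+ m) ≈ P d * Q m
  convolution-single zero P Q zero z = refl
  convolution-single zero P Q (suc m) z =
    trans (+-cong refl (convolution-vanishes _ Q m (λ b b≤m → z b (ℕₚ.<⇒≢ (ℕ.s≤s b≤m))))) (+-identityʳ _)
  convolution-single (suc d) P Q m z = begin
    P 0 * Q (suc (d ℕ.+ m)) + convolution (λ i → P (suc i)) Q (d ℕ.+ m)
      ≈⟨ +-cong (*-cong refl (z _ (ℕₚ.>⇒≢ (ℕ.s≤s (ℕₚ.m≤n+m m d))))) (convolution-single d _ Q m z) ⟩
    P 0 * 0# + P (suc d) * Q m  ≈⟨ +-cong (zeroʳ _) refl ⟩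
    0# + P (suc d) * Q m        ≈⟨ +-identityˡ _ ⟩
    P (suc d) * Q m             ∎

  convolution-zeroˡ : ∀ Q n → convolution (λ _ → 0#) Q n ≈ 0#
  convolution-zeroˡ Q zero = zeroˡ _
  convolution-zeroˡ Q (suc n) = trans (+-cong (zeroˡ _) (convolution-zeroˡ Q n)) (+-identityˡ 0#)

  coeff-pmul : ∀ p q n → coeff (pmul p q) n ≈ convolution (coeff p) (coeff q) n
  coeff-pmul [] q n = sym (convolution-zeroˡ (coeff q) n)
  coeff-pmul (a ∷ p) q zero = trans (coeff-pmul-∷ a p q zero) (+-identityʳ _)
  coeff-pmul (a ∷ p) q (suc n) = trans (coeff-pmul-∷ a p q (suc n)) (+-cong refl (coeff-pmul p q n))

  ≈ᴾ-pconst : ∀ p → (∀ j → coeff p (suc j) ≈ 0#) → p ≈ᴾ pconst (coeff p 0)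
  ≈ᴾ-pconst p z .at zero = refl
  ≈ᴾ-pconst p z .at (suc j) = z j

  coeff-pmul-constantˡ : ∀ p q → (∀ j → coeff p (suc j) ≈ 0#) → ∀ k → coeff (pmul p q) k ≈ coeff p 0 * coeff q k
  coeff-pmul-constantˡ p q z k = begin
    coeff (pmul p q) k                 ≈⟨ pmul-congˡ q (≈ᴾ-pconst p z) .at k ⟩
    coeff (pmul (pconst (coeff p 0)) q) k ≈⟨ pmul-pconstˡ (coeff p 0) q .at k ⟩
    coeff (map (coeff p 0 *_) q) k     ≈⟨ coeff-scale (coeff p 0) q k ⟩
    coeff p 0 * coeff q k              ∎

  pconst-isRingHomomorphism : IsRingHomomorphism rawRing (CommutativeRing.rawRing commutativeRing) pconst
  pconst-isRingHomomorphism = isRingHomomorphism R commutativeRing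
    (λ e → coeffwise λ { zero → e ; (suc n) → refl })
    (λ x y → ≈ᴾ-refl)
    (λ x y → ≈ᴾ-sym (pmul-pconstˡ x (pconst y)))
    (λ x → ≈ᴾ-refl)
    (coeffwise λ { zero → refl ; (suc n) → refl })
    ≈ᴾ-refl

module Polynomial² {ℓ} (R : CommutativeRing 0ℓ ℓ) where
  open CommutativeRing R hiding (zero) renaming (Carrier to C)
  open PolyOps (toRawR R)
  private
    module P = Polynomial R
    module P² = Polynomial P.commutativeRing

  coeff-convolution-constantˡ : ∀ F G N k → (∀ a j → coeff (F a) (suc j) ≈ 0#) →
    coeff (P².convolution F G N) k ≈ P.convolution (λ a → coeff (F a) 0) (λ b → coeff (G b) k) N
  coeff-convolution-constantˡ F G zero k z = P.coeff-pmul-constantˡ (F 0) (G 0) (z 0) k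
  coeff-convolution-constantˡ F G (suc N) k z =
    trans (P.coeff-padd (pmul (F 0) (G (suc N))) (P².convolution (λ i → F (suc i)) G N) k)
      (+-cong (P.coeff-pmul-constantˡ (F 0) (G (suc N)) (z 0) k)
              (coeff-convolution-constantˡ (λ i → F (suc i)) G N k (λ a → z (suc a))))

-- Powers, evaluation and coefficient maps

module Power {ℓ} (R : CommutativeRing 0ℓ ℓ) where
  open CommutativeRing R hiding (zero) renaming (Carrier to C)
  open import Algebra.Properties.CommutativeSemigroup *-commutativeSemigroup using (interchange)

  infixr 8 _^_
  _^_ : C → ℕ → C
  _^_ = powR (toRawR R)

  ^-congˡ : ∀ {a b} n → a ≈ b → a ^ n ≈ b ^ n
  ^-congˡ zero e = refl
  ^-congˡ (suc n) e = *-cong e (^-congˡ n e)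

  ^-distrib-* : ∀ a b n → (a * b) ^ n ≈ a ^ n * b ^ n
  ^-distrib-* a b zero = sym (*-identityˡ 1#)
  ^-distrib-* a b (suc n) = trans (*-cong refl (^-distrib-* a b n)) (interchange a b _ _)

module _ {ℓ} (R : CommutativeRing 0ℓ ℓ) where
  open CommutativeRing R
  open import Algebra.Properties.Ring ring using (-‿involutive; -‿distribˡ-*)
  open import Relation.Binary.Reasoning.Setoid setoid

  difference-of-squares : ∀ x c → (x - c) * (x - - c) ≈ x * x - c * c
  difference-of-squares x c = begin
    (x - c) * (x - - c)                   ≈⟨ *-cong refl (+-cong refl (-‿involutive c)) ⟩
    (x - c) * (x + c)                     ≈⟨ distribʳ (x + c) x (- c) ⟩
    x * (x + c) + - c * (x + c)           ≈⟨ +-cong (distribˡ x x c) (distribˡ (- c) x c) ⟩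
    (x * x + x * c) + (- c * x + - c * c) ≈⟨ +-cong refl (+-cong (-‿distribˡ-* c x) (-‿distribˡ-* c c)) ⟨
    (x * x + x * c) + (- (c * x) - c * c) ≈⟨ +-assoc (x * x) (x * c) _ ⟩
    x * x + (x * c + (- (c * x) - c * c)) ≈⟨ +-cong refl (+-assoc (x * c) _ _) ⟨
    x * x + ((x * c - c * x) - c * c)     ≈⟨ +-cong refl (+-cong (trans (+-cong (*-comm x c) refl) (-‿inverseʳ (c * x))) refl) ⟩
    x * x + (0# - c * c)                  ≈⟨ +-cong refl (+-identityˡ _) ⟩
    x * x - c * c                         ∎

module _ {ℓ₁ ℓ₂} (R : CommutativeRing 0ℓ ℓ₁) (S : CommutativeRing 0ℓ ℓ₂)
         {f : CommutativeRing.Carrier R → CommutativeRing.Carrier S}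
         (f-hom : IsRingHomomorphism (CommutativeRing.rawRing R) (CommutativeRing.rawRing S) f) where
  open CommutativeRing S hiding (zero)
  open IsRingHomomorphism f-hom

  powR-homo : ∀ a n → f (powR (toRawR R) a n) ≈ powR (toRawR S) (f a) n
  powR-homo a zero = 1#-homo
  powR-homo a (suc n) = trans (*-homo a _) (*-cong refl (powR-homo a n))

module Evaluation {ℓ₁ ℓ₂} (R : CommutativeRing 0ℓ ℓ₁) (S : CommutativeRing 0ℓ ℓ₂)
                  {f : CommutativeRing.Carrier R → CommutativeRing.Carrier S}
                  (f-hom : IsRingHomomorphism (CommutativeRing.rawRing R) (CommutativeRing.rawRing S) f)
                  (s : CommutativeRing.Carrier S) where
  private
    module R = CommutativeRing R
    module P = Polynomial R
  open CommutativeRing S hiding (zero)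
  open IsRingHomomorphism f-hom
  open PolyOps (toRawR R)
  open import Algebra.Properties.Ring ring using (-0#≈0#; -‿distribʳ-*; -‿+-comm)
  open import Algebra.Properties.CommutativeSemigroup +-commutativeSemigroup using (interchange)
  open import Algebra.Properties.CommutativeSemigroup *-commutativeSemigroup using (x∙yz≈y∙xz)

  ev : Poly R.Carrier → Carrier
  ev p = evalAt (toRawR S) f p s

  ev-shift : ∀ q → ev (P.shift q) ≈ s * ev q
  ev-shift q = trans (+-cong 0#-homo refl) (+-identityˡ _)

  ev-zero : ∀ q → q P.≈ᴾ [] → ev q ≈ 0#
  ev-zero [] e = refl
  ev-zero (a ∷ p) e = begin
    f a + s * ev p  ≈⟨ +-cong (trans (⟦⟧-cong (e .P.at 0)) 0#-homo)
                              (*-cong refl (ev-zero p (P.coeffwise λ n → e .P.at (suc n)))) ⟩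
    0# + s * 0#     ≈⟨ +-identityˡ _ ⟩
    s * 0#          ≈⟨ zeroʳ s ⟩
    0#              ∎
    where open import Relation.Binary.Reasoning.Setoid setoid

  ev-cong : ∀ {p q} → p P.≈ᴾ q → ev p ≈ ev q
  ev-cong {[]} {[]} e = refl
  ev-cong {[]} {b ∷ q} e = sym (ev-zero (b ∷ q) (P.≈ᴾ-sym e))
  ev-cong {a ∷ p} {[]} e = ev-zero (a ∷ p) e
  ev-cong {a ∷ p} {b ∷ q} e = +-cong (⟦⟧-cong (e .P.at 0)) (*-cong refl (ev-cong {p} {q} (P.coeffwise λ n → e .P.at (suc n))))

  ev-padd : ∀ p q → ev (padd p q) ≈ ev p + ev q
  ev-padd [] q = sym (+-identityˡ _)
  ev-padd (a ∷ p) [] = sym (+-identityʳ _)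
  ev-padd (a ∷ p) (b ∷ q) =
    trans (+-cong (+-homo a b) (trans (*-cong refl (ev-padd p q)) (distribˡ s _ _))) (interchange _ _ _ _)

  ev-scale : ∀ a q → ev (map (a R.*_) q) ≈ f a * ev q
  ev-scale a [] = sym (zeroʳ _)
  ev-scale a (b ∷ q) =
    trans (+-cong (*-homo a b) (trans (*-cong refl (ev-scale a q)) (x∙yz≈y∙xz s (f a) (ev q))))
          (sym (distribˡ (f a) _ _))

  ev-pmul : ∀ p q → ev (pmul p q) ≈ ev p * ev q
  ev-pmul [] q = sym (zeroˡ _)
  ev-pmul (a ∷ p) q = begin
    ev (padd (map (a R.*_) q) (P.shift (pmul p q)))  ≈⟨ ev-padd (map (a R.*_) q) (P.shift (pmul p q)) ⟩
    ev (map (a R.*_) q) + ev (P.shift (pmul p q))    ≈⟨ +-cong (ev-scale a q) (ev-shift (pmul p q)) ⟩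
    f a * ev q + s * ev (pmul p q)                   ≈⟨ +-cong refl (*-cong refl (ev-pmul p q)) ⟩
    f a * ev q + s * (ev p * ev q)                   ≈⟨ +-cong refl (*-assoc s (ev p) (ev q)) ⟨
    f a * ev q + (s * ev p) * ev q                   ≈⟨ distribʳ (ev q) (f a) (s * ev p) ⟨
    (f a + s * ev p) * ev q                          ∎
    where open import Relation.Binary.Reasoning.Setoid setoid

  ev-pneg : ∀ p → ev (pneg p) ≈ - ev p
  ev-pneg [] = sym -0#≈0#
  ev-pneg (a ∷ p) =
    trans (+-cong (-‿homo a) (trans (*-cong refl (ev-pneg p)) (sym (-‿distribʳ-* s (ev p))))) (-‿+-comm _ _)

  ev-pconst : ∀ a → ev (pconst a) ≈ f a
  ev-pconst a = trans (+-cong refl (zeroʳ s)) (+-identityʳ _)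

  ev-pX : ev pX ≈ s
  ev-pX = trans (ev-shift (pconst R.1#)) (trans (*-cong refl (trans (ev-pconst R.1#) 1#-homo)) (*-identityʳ s))

  ev-isRingHomomorphism : IsRingHomomorphism (CommutativeRing.rawRing P.commutativeRing) rawRing ev
  ev-isRingHomomorphism = isRingHomomorphism P.commutativeRing S
    ev-cong ev-padd ev-pmul ev-pneg refl (trans (ev-pconst R.1#) 1#-homo)

module CoefficientMap {ℓ₁ ℓ₂} (R : CommutativeRing 0ℓ ℓ₁) (S : CommutativeRing 0ℓ ℓ₂)
                      {f : CommutativeRing.Carrier R → CommutativeRing.Carrier S}
                      (f-hom : IsRingHomomorphism (CommutativeRing.rawRing R) (CommutativeRing.rawRing S) f) where
  private
    module R = CommutativeRing R
    module PR = Polynomial R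
    module PS = Polynomial S
    module OR = PolyOps (toRawR R)
    module OS = PolyOps (toRawR S)
  open CommutativeRing S hiding (zero)
  open IsRingHomomorphism f-hom

  coeff-map-homo : ∀ p n → OS.coeff (map f p) n ≈ f (OR.coeff p n)
  coeff-map-homo [] n = sym 0#-homo
  coeff-map-homo (a ∷ p) zero = refl
  coeff-map-homo (a ∷ p) (suc n) = coeff-map-homo p n

  map-cong : ∀ {p q} → p PR.≈ᴾ q → map f p PS.≈ᴾ map f q
  map-cong {p} {q} e .PS.at n =
    trans (coeff-map-homo p n) (trans (⟦⟧-cong (e .PR.at n)) (sym (coeff-map-homo q n)))

  map-padd : ∀ p q → map f (OR.padd p q) PS.≈ᴾ OS.padd (map f p) (map f q)
  map-padd p q .PS.at n = begin
    OS.coeff (map f (OR.padd p q)) n                  ≈⟨ coeff-map-homo (OR.padd p q) n ⟩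
    f (OR.coeff (OR.padd p q) n)                      ≈⟨ ⟦⟧-cong (PR.coeff-padd p q n) ⟩
    f (OR.coeff p n R.+ OR.coeff q n)                 ≈⟨ +-homo _ _ ⟩
    f (OR.coeff p n) + f (OR.coeff q n)               ≈⟨ +-cong (coeff-map-homo p n) (coeff-map-homo q n) ⟨
    OS.coeff (map f p) n + OS.coeff (map f q) n       ≈⟨ PS.coeff-padd (map f p) (map f q) n ⟨
    OS.coeff (OS.padd (map f p) (map f q)) n          ∎
    where open import Relation.Binary.Reasoning.Setoid setoid

  map-shift : ∀ p → map f (PR.shift p) PS.≈ᴾ PS.shift (map f p)
  map-shift p .PS.at zero = 0#-homo
  map-shift p .PS.at (suc n) = refl

  map-pmul : ∀ p q → map f (OR.pmul p q) PS.≈ᴾ OS.pmul (map f p) (map f q)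
  map-pmul [] q = PS.≈ᴾ-refl
  map-pmul (a ∷ p) q = PS.≈ᴾ-trans (map-padd (map (a R.*_) q) (PR.shift (OR.pmul p q)))
    (PS.padd-cong scale (PS.≈ᴾ-trans (map-shift (OR.pmul p q)) (PS.shift-cong (map-pmul p q))))
    where
    scale : map f (map (a R.*_) q) PS.≈ᴾ map (f a *_) (map f q)
    scale .PS.at n = begin
      OS.coeff (map f (map (a R.*_) q)) n   ≈⟨ coeff-map-homo (map (a R.*_) q) n ⟩
      f (OR.coeff (map (a R.*_) q) n)       ≈⟨ ⟦⟧-cong (PR.coeff-scale a q n) ⟩
      f (a R.* OR.coeff q n)                ≈⟨ *-homo _ _ ⟩
      f a * f (OR.coeff q n)                ≈⟨ *-cong refl (coeff-map-homo q n) ⟨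
      f a * OS.coeff (map f q) n            ≈⟨ PS.coeff-scale (f a) (map f q) n ⟨
      OS.coeff (map (f a *_) (map f q)) n   ∎
      where open import Relation.Binary.Reasoning.Setoid setoid

  map-pneg : ∀ p → map f (OR.pneg p) PS.≈ᴾ OS.pneg (map f p)
  map-pneg p .PS.at n =
    trans (coeff-map-homo (OR.pneg p) n) (trans (⟦⟧-cong (PR.coeff-pneg p n))
      (trans (-‿homo _) (sym (trans (PS.coeff-pneg (map f p) n) (-‿cong (coeff-map-homo p n))))))

  map-isRingHomomorphism : IsRingHomomorphism (CommutativeRing.rawRing PR.commutativeRing)
                                              (CommutativeRing.rawRing PS.commutativeRing) (map f)
  map-isRingHomomorphism = isRingHomomorphism PR.commutativeRing PS.commutativeRing
    map-cong map-padd map-pmul map-pneg PS.≈ᴾ-refl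
    (PS.coeffwise λ { zero → 1#-homo ; (suc n) → refl })

  map-pX : map f OR.pX PS.≈ᴾ OS.pX
  map-pX .PS.at zero = 0#-homo
  map-pX .PS.at (suc zero) = 1#-homo
  map-pX .PS.at (suc (suc n)) = refl

-- Specialising t₁ ↦ t, t₂ ↦ -t

ℤ-ring ℤPoly₁ ℤPoly₂ ℤPoly₃ : CommutativeRing 0ℓ 0ℓ
ℤ-ring = ℤₚ.+-*-commutativeRing
ℤPoly₁ = Polynomial.commutativeRing ℤ-ring
ℤPoly₂ = Polynomial.commutativeRing ℤPoly₁
ℤPoly₃ = Polynomial.commutativeRing ℤPoly₂

module P₁ = Polynomial ℤ-ring
module P₂ = Polynomial ℤPoly₁

negateVariable : Poly ℤ → Poly ℤ
negateVariable c = O1.evalAt P1R O1.pconst c (O1.pneg O1.pX)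

-- b(t₁, t₂) ↦ b(t, -t), reading Poly (Poly ℤ) as ℤ[t₂][t₁]
specialise : Poly (Poly ℤ) → Poly ℤ
specialise b = O2.evalAt P1R negateVariable b O1.pX

module NegateVariable = Evaluation ℤ-ring ℤPoly₁ P₁.pconst-isRingHomomorphism (O1.pneg O1.pX)
module Specialise = Evaluation ℤPoly₁ ℤPoly₁ NegateVariable.ev-isRingHomomorphism O1.pX
module SpecialiseCoeffs = CoefficientMap ℤPoly₂ ℤPoly₁ Specialise.ev-isRingHomomorphism

-- bₚ p is the x^(2A)-coefficient of bProduct A (2 * A)
bProduct : ℕ → ℕ → Poly (Poly (Poly ℤ))
bProduct a n = O3.pmul (powR P3R (O3.padd X₃ (O3.pneg One₃)) n)
                 (O3.pmul (powR P3R (O3.padd X₃ (O3.pneg T₁)) a) (powR P3R (O3.padd X₃ (O3.pneg T₂)) a))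

module _ where
  open CommutativeRing ℤPoly₂ hiding (zero)
  open Power ℤPoly₂ using (_^_; ^-congˡ; ^-distrib-*)
  open IsRingHomomorphism SpecialiseCoeffs.map-isRingHomomorphism
  open import Relation.Binary.Reasoning.Setoid setoid

  x t : Poly (Poly ℤ)
  x = O2.pX
  t = O2.pconst O1.pX

  private
    specialise-x-minus : ∀ c c′ → map specialise c ≈ c′ → map specialise (O3.padd X₃ (O3.pneg c)) ≈ x - c′
    specialise-x-minus c c′ e = trans (+-homo X₃ (O3.pneg c)) (+-cong SpecialiseCoeffs.map-pX (trans (-‿homo c) (-‿cong e)))

    specialise-T₁ : map specialise T₁ ≈ t
    specialise-T₁ = IsRingHomomorphism.⟦⟧-cong P₂.pconst-isRingHomomorphism Specialise.ev-pX

    specialise-T₂ : map specialise T₂ ≈ - t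
    specialise-T₂ = IsRingHomomorphism.⟦⟧-cong P₂.pconst-isRingHomomorphism
      (P₁.≈ᴾ-trans (Specialise.ev-pconst O1.pX) NegateVariable.ev-pX)

  specialise-bProduct : ∀ a n → map specialise (bProduct a n) ≈ (x - 1#) ^ n * (x * x - t * t) ^ a
  specialise-bProduct a n = begin
    map specialise (bProduct a n)
      ≈⟨ *-homo (powR P3R L₀ n) _ ⟩
    map specialise (powR P3R L₀ n) * map specialise (O3.pmul (powR P3R L₁ a) (powR P3R L₂ a))
      ≈⟨ P₂.pmul-congʳ (map specialise (powR P3R L₀ n)) (*-homo (powR P3R L₁ a) _) ⟩
    map specialise (powR P3R L₀ n) * (map specialise (powR P3R L₁ a) * map specialise (powR P3R L₂ a))
      ≈⟨ *-cong (specialise-powR L₀ n) (*-cong (specialise-powR L₁ a) (specialise-powR L₂ a)) ⟩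
    map specialise L₀ ^ n * (map specialise L₁ ^ a * map specialise L₂ ^ a)
      ≈⟨ *-cong (^-congˡ n (specialise-x-minus One₃ 1# 1#-homo))
                (*-cong (^-congˡ a (specialise-x-minus T₁ t specialise-T₁))
                        (^-congˡ a (specialise-x-minus T₂ (- t) specialise-T₂))) ⟩
    (x - 1#) ^ n * ((x - t) ^ a * (x - - t) ^ a)
      ≈⟨ P₂.pmul-congʳ ((x - 1#) ^ n) (^-distrib-* (x - t) (x - - t) a) ⟨
    (x - 1#) ^ n * ((x - t) * (x - - t)) ^ a
      ≈⟨ P₂.pmul-congʳ ((x - 1#) ^ n) (^-congˡ a (difference-of-squares ℤPoly₂ x t)) ⟩
    (x - 1#) ^ n * (x * x - t * t) ^ a
      ∎
    where
    specialise-powR : ∀ L m → map specialise (powR P3R L m) ≈ map specialise L ^ m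
    specialise-powR = powR-homo ℤPoly₃ ℤPoly₂ SpecialiseCoeffs.map-isRingHomomorphism
    L₀ L₁ L₂ : Poly (Poly (Poly ℤ))
    L₀ = O3.padd X₃ (O3.pneg One₃)
    L₁ = O3.padd X₃ (O3.pneg T₁)
    L₂ = O3.padd X₃ (O3.pneg T₂)

-- Coefficients of (x - 1)ⁿ and (x² - t²)ⁿ

open import Relation.Binary.PropositionalEquality using (_≡_; refl; sym; trans; cong; cong₂; module ≡-Reasoning)

coeff₂ : Poly (Poly ℤ) → ℕ → ℕ → ℤ
coeff₂ P b k = O1.coeff (O2.coeff P b) k

shiftSeq : (ℕ → ℤ) → ℕ → ℤ
shiftSeq g zero = + 0
shiftSeq g (suc b) = g b

shiftSeq-cong : ∀ {g h} → (∀ i → g i ≡ h i) → ∀ b → shiftSeq g b ≡ shiftSeq h b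
shiftSeq-cong e zero = refl
shiftSeq-cong e (suc b) = e b

module _ where
  open CommutativeRing ℤPoly₂ using (_+_; _*_; -_; _-_; 1#; *-assoc; *-identityˡ; ring)
  open Power ℤPoly₂ using (_^_)
  open import Algebra.Properties.Ring ring using ([y-z]x≈yx-zx)
  open ≡-Reasoning

  coeff₂-cong : ∀ {P Q} → P P₂.≈ᴾ Q → ∀ b k → coeff₂ P b k ≡ coeff₂ Q b k
  coeff₂-cong e b k = e .P₂.at b .P₁.at k

  coeff₂-padd : ∀ P Q b k → coeff₂ (P + Q) b k ≡ coeff₂ P b k ℤ.+ coeff₂ Q b k
  coeff₂-padd P Q b k = trans (P₂.coeff-padd P Q b .P₁.at k) (P₁.coeff-padd (O2.coeff P b) (O2.coeff Q b) k)

  coeff₂-pneg : ∀ P b k → coeff₂ (- P) b k ≡ ℤ.- coeff₂ P b k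
  coeff₂-pneg P b k = trans (P₂.coeff-pneg P b .P₁.at k) (P₁.coeff-pneg (O2.coeff P b) k)

  coeff₂-x* : ∀ Q b k → coeff₂ (x * Q) b k ≡ shiftSeq (λ b′ → coeff₂ Q b′ k) b
  coeff₂-x* Q zero k = coeff₂-cong (P₂.pmul-pXˡ Q) zero k
  coeff₂-x* Q (suc b) k = coeff₂-cong (P₂.pmul-pXˡ Q) (suc b) k

  coeff₂-t* : ∀ Q b k → coeff₂ (t * Q) b k ≡ shiftSeq (coeff₂ Q b) k
  coeff₂-t* Q b k = begin
    coeff₂ (t * Q) b k                          ≡⟨ coeff₂-cong (P₂.pmul-pconstˡ O1.pX Q) b k ⟩
    O1.coeff (O2.coeff (map (O1.pmul O1.pX) Q) b) k ≡⟨ P₂.coeff-scale O1.pX Q b .P₁.at k ⟩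
    O1.coeff (O1.pmul O1.pX (O2.coeff Q b)) k   ≡⟨ P₁.pmul-pXˡ (O2.coeff Q b) .P₁.at k ⟩
    O1.coeff (P₁.shift (O2.coeff Q b)) k        ≡⟨ shift-coeff k ⟩
    shiftSeq (coeff₂ Q b) k                     ∎
    where
    shift-coeff : ∀ k → O1.coeff (P₁.shift (O2.coeff Q b)) k ≡ shiftSeq (coeff₂ Q b) k
    shift-coeff zero = refl
    shift-coeff (suc k) = refl

  coeff₂-[x-1]* : ∀ Q b k → coeff₂ ((x - 1#) * Q) b k ≡ shiftSeq (λ b′ → coeff₂ Q b′ k) b ℤ.- coeff₂ Q b k
  coeff₂-[x-1]* Q b k = begin
    coeff₂ ((x - 1#) * Q) b k                ≡⟨ coeff₂-cong (P₂.≈ᴾ-trans ([y-z]x≈yx-zx Q x 1#)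
                                                  (P₂.padd-cong P₂.≈ᴾ-refl (P₂.pneg-cong (*-identityˡ Q)))) b k ⟩
    coeff₂ (x * Q - Q) b k                   ≡⟨ coeff₂-padd (x * Q) (- Q) b k ⟩
    coeff₂ (x * Q) b k ℤ.+ coeff₂ (- Q) b k  ≡⟨ cong₂ ℤ._+_ (coeff₂-x* Q b k) (coeff₂-pneg Q b k) ⟩
    shiftSeq (λ b′ → coeff₂ Q b′ k) b ℤ.- coeff₂ Q b k ∎

  coeff₂-[x²-t²]* : ∀ Q b k → coeff₂ ((x * x - t * t) * Q) b k ≡
    shiftSeq (shiftSeq (λ b′ → coeff₂ Q b′ k)) b ℤ.- shiftSeq (shiftSeq (coeff₂ Q b)) k
  coeff₂-[x²-t²]* Q b k = begin
    coeff₂ ((x * x - t * t) * Q) b k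
      ≡⟨ coeff₂-cong (P₂.≈ᴾ-trans ([y-z]x≈yx-zx Q (x * x) (t * t))
           (P₂.padd-cong (*-assoc x x Q) (P₂.pneg-cong (*-assoc t t Q)))) b k ⟩
    coeff₂ (x * (x * Q) - t * (t * Q)) b k
      ≡⟨ coeff₂-padd (x * (x * Q)) (- (t * (t * Q))) b k ⟩
    coeff₂ (x * (x * Q)) b k ℤ.+ coeff₂ (- (t * (t * Q))) b k
      ≡⟨ cong₂ ℤ._+_ (coeff₂-x* (x * Q) b k) (coeff₂-pneg (t * (t * Q)) b k) ⟩
    shiftSeq (λ b′ → coeff₂ (x * Q) b′ k) b ℤ.- coeff₂ (t * (t * Q)) b k
      ≡⟨ cong₂ ℤ._-_ (shiftSeq-cong (λ b′ → coeff₂-x* Q b′ k) b) (coeff₂-t* (t * Q) b k) ⟩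
    shiftSeq (shiftSeq (λ b′ → coeff₂ Q b′ k)) b ℤ.- shiftSeq (coeff₂ (t * Q) b) k
      ≡⟨ cong (λ z → shiftSeq (shiftSeq (λ b′ → coeff₂ Q b′ k)) b ℤ.- z) (shiftSeq-cong (coeff₂-t* Q b) k) ⟩
    shiftSeq (shiftSeq (λ b′ → coeff₂ Q b′ k)) b ℤ.- shiftSeq (shiftSeq (coeff₂ Q b)) k
      ∎

  [x-1]^ [x²-t²]^ : ℕ → ℕ → ℕ → ℤ
  [x-1]^ zero b k = coeff₂ 1# b k
  [x-1]^ (suc n) b k = shiftSeq (λ b′ → [x-1]^ n b′ k) b ℤ.- [x-1]^ n b k
  [x²-t²]^ zero b k = coeff₂ 1# b k
  [x²-t²]^ (suc n) b k = shiftSeq (shiftSeq (λ b′ → [x²-t²]^ n b′ k)) b ℤ.- shiftSeq (shiftSeq ([x²-t²]^ n b)) k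

  coeff₂-[x-1]^ : ∀ n b k → coeff₂ ((x - 1#) ^ n) b k ≡ [x-1]^ n b k
  coeff₂-[x-1]^ zero b k = refl
  coeff₂-[x-1]^ (suc n) b k = trans (coeff₂-[x-1]* ((x - 1#) ^ n) b k)
    (cong₂ ℤ._-_ (shiftSeq-cong (λ b′ → coeff₂-[x-1]^ n b′ k) b) (coeff₂-[x-1]^ n b k))

  coeff₂-[x²-t²]^ : ∀ n b k → coeff₂ ((x * x - t * t) ^ n) b k ≡ [x²-t²]^ n b k
  coeff₂-[x²-t²]^ zero b k = refl
  coeff₂-[x²-t²]^ (suc n) b k = trans (coeff₂-[x²-t²]* ((x * x - t * t) ^ n) b k)
    (cong₂ ℤ._-_ (shiftSeq-cong (shiftSeq-cong (λ b′ → coeff₂-[x²-t²]^ n b′ k)) b)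
                 (shiftSeq-cong (shiftSeq-cong (coeff₂-[x²-t²]^ n b)) k))

  [x-1]^-t-free : ∀ n b j → [x-1]^ n b (suc j) ≡ + 0
  [x-1]^-t-free zero zero j = refl
  [x-1]^-t-free zero (suc b) j = refl
  [x-1]^-t-free (suc n) zero j = cong (λ z → + 0 ℤ.- z) ([x-1]^-t-free n zero j)
  [x-1]^-t-free (suc n) (suc b) j = cong₂ ℤ._-_ ([x-1]^-t-free n b j) ([x-1]^-t-free n (suc b) j)

  [x-1]^-above : ∀ n b → n < b → [x-1]^ n b 0 ≡ + 0
  [x-1]^-above zero (suc b) _ = refl
  [x-1]^-above (suc n) (suc b) (ℕ.s≤s n<b) =
    cong₂ ℤ._-_ ([x-1]^-above n b n<b) ([x-1]^-above n (suc b) (ℕₚ.m<n⇒m<1+n n<b))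

  [x-1]^-leading : ∀ n → [x-1]^ n n 0 ≡ + 1
  [x-1]^-leading zero = refl
  [x-1]^-leading (suc n) = cong₂ ℤ._-_ ([x-1]^-leading n) ([x-1]^-above n (suc n) (ℕₚ.n<1+n n))

  [x-1]^-constant : ∀ n → [x-1]^ n 0 0 ≡ -1ℤ ℤ.^ n
  [x-1]^-constant zero = refl
  [x-1]^-constant (suc n) = begin
    + 0 ℤ.- [x-1]^ n 0 0    ≡⟨ ℤₚ.+-identityˡ _ ⟩
    ℤ.- [x-1]^ n 0 0        ≡⟨ cong ℤ.-_ ([x-1]^-constant n) ⟩
    ℤ.- (-1ℤ ℤ.^ n)         ≡⟨ ℤₚ.-1*i≡-i _ ⟨
    -1ℤ ℤ.^ suc n           ∎

  [x-1]^-linear : ∀ n → [x-1]^ n 1 0 ≡ ℤ.- (-1ℤ ℤ.^ n ℤ.* + n)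
  [x-1]^-linear zero = refl
  [x-1]^-linear (suc n) = begin
    [x-1]^ n 0 0 ℤ.- [x-1]^ n 1 0
      ≡⟨ cong₂ ℤ._-_ ([x-1]^-constant n) ([x-1]^-linear n) ⟩
    -1ℤ ℤ.^ n ℤ.- ℤ.- (-1ℤ ℤ.^ n ℤ.* + n)
      ≡⟨ step (-1ℤ ℤ.^ n) (+ n) ⟩
    ℤ.- ((-1ℤ ℤ.* -1ℤ ℤ.^ n) ℤ.* (+ 1 ℤ.+ + n))
      ≡⟨ cong (λ z → ℤ.- (-1ℤ ℤ.^ suc n ℤ.* z)) (ℤₚ.pos-+ 1 n) ⟨
    ℤ.- (-1ℤ ℤ.^ suc n ℤ.* + suc n)
      ∎
    where
    step : ∀ s m → s ℤ.- ℤ.- (s ℤ.* m) ≡ ℤ.- ((-1ℤ ℤ.* s) ℤ.* (+ 1 ℤ.+ m))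
    step = solve-∀

  [x-1]^-quadratic : ∀ n → + 2 ℤ.* [x-1]^ n 2 0 ≡ -1ℤ ℤ.^ n ℤ.* (+ n ℤ.* (+ n ℤ.- + 1))
  [x-1]^-quadratic zero = refl
  [x-1]^-quadratic (suc n) = begin
    + 2 ℤ.* ([x-1]^ n 1 0 ℤ.- [x-1]^ n 2 0)
      ≡⟨ ℤₚ.*-distribˡ-+ (+ 2) ([x-1]^ n 1 0) (ℤ.- [x-1]^ n 2 0) ⟩
    + 2 ℤ.* [x-1]^ n 1 0 ℤ.+ + 2 ℤ.* ℤ.- [x-1]^ n 2 0
      ≡⟨ cong (λ z → + 2 ℤ.* [x-1]^ n 1 0 ℤ.+ z) (ℤₚ.neg-distribʳ-* (+ 2) _) ⟨
    + 2 ℤ.* [x-1]^ n 1 0 ℤ.- + 2 ℤ.* [x-1]^ n 2 0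
      ≡⟨ cong₂ (λ u v → + 2 ℤ.* u ℤ.- v) ([x-1]^-linear n) ([x-1]^-quadratic n) ⟩
    + 2 ℤ.* ℤ.- (-1ℤ ℤ.^ n ℤ.* + n) ℤ.- -1ℤ ℤ.^ n ℤ.* (+ n ℤ.* (+ n ℤ.- + 1))
      ≡⟨ step (-1ℤ ℤ.^ n) (+ n) ⟩
    (-1ℤ ℤ.* -1ℤ ℤ.^ n) ℤ.* ((+ 1 ℤ.+ + n) ℤ.* ((+ 1 ℤ.+ + n) ℤ.- + 1))
      ≡⟨ cong (λ z → -1ℤ ℤ.^ suc n ℤ.* (z ℤ.* (z ℤ.- + 1))) (ℤₚ.pos-+ 1 n) ⟨
    -1ℤ ℤ.^ suc n ℤ.* (+ suc n ℤ.* (+ suc n ℤ.- + 1))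
      ∎
    where
    step : ∀ s m → + 2 ℤ.* ℤ.- (s ℤ.* m) ℤ.- s ℤ.* (m ℤ.* (m ℤ.- + 1)) ≡
                   (-1ℤ ℤ.* s) ℤ.* ((+ 1 ℤ.+ m) ℤ.* ((+ 1 ℤ.+ m) ℤ.- + 1))
    step = solve-∀

  [x²-t²]^-homogeneous : ∀ n b k → b ℕ.+ k ≢ n ℕ.+ n → [x²-t²]^ n b k ≡ + 0
  [x²-t²]^-homogeneous zero zero zero h = ⊥-elim (h refl)
  [x²-t²]^-homogeneous zero zero (suc k) h = refl
  [x²-t²]^-homogeneous zero (suc b) k h = refl
  [x²-t²]^-homogeneous (suc n) b k h = cong₂ ℤ._-_ (x²-part b h) (t²-part k h)
    where
    2+2n : suc n ℕ.+ suc n ≡ 2 ℕ.+ (n ℕ.+ n)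
    2+2n = cong suc (ℕₚ.+-suc n n)
    x²-part : ∀ b → b ℕ.+ k ≢ suc n ℕ.+ suc n → shiftSeq (shiftSeq (λ b′ → [x²-t²]^ n b′ k)) b ≡ + 0
    x²-part zero h = refl
    x²-part (suc zero) h = refl
    x²-part (suc (suc b)) h = [x²-t²]^-homogeneous n b k (λ e → h (trans (cong (2 ℕ.+_) e) (sym 2+2n)))
    t²-part : ∀ k → b ℕ.+ k ≢ suc n ℕ.+ suc n → shiftSeq (shiftSeq ([x²-t²]^ n b)) k ≡ + 0
    t²-part zero h = refl
    t²-part (suc zero) h = refl
    t²-part (suc (suc k)) h = [x²-t²]^-homogeneous n b k λ e → h (begin
      b ℕ.+ suc (suc k)  ≡⟨ ℕₚ.+-suc b (suc k) ⟩
      suc (b ℕ.+ suc k)  ≡⟨ cong suc (ℕₚ.+-suc b k) ⟩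
      2 ℕ.+ (b ℕ.+ k)    ≡⟨ cong (2 ℕ.+_) e ⟩
      2 ℕ.+ (n ℕ.+ n)    ≡⟨ 2+2n ⟨
      suc n ℕ.+ suc n    ∎)

  [x²-t²]^-odd : ∀ n b j → [x²-t²]^ n b (suc (j ℕ.+ j)) ≡ + 0
  [x²-t²]^-odd zero zero j = refl
  [x²-t²]^-odd zero (suc b) j = refl
  [x²-t²]^-odd (suc n) b j = cong₂ ℤ._-_ (x²-part b) (t²-part j)
    where
    x²-part : ∀ b → shiftSeq (shiftSeq (λ b′ → [x²-t²]^ n b′ (suc (j ℕ.+ j)))) b ≡ + 0
    x²-part zero = refl
    x²-part (suc zero) = refl
    x²-part (suc (suc b)) = [x²-t²]^-odd n b j
    t²-part : ∀ j → shiftSeq (shiftSeq ([x²-t²]^ n b)) (suc (j ℕ.+ j)) ≡ + 0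
    t²-part zero = refl
    t²-part (suc j) = trans (cong (λ i → shiftSeq ([x²-t²]^ n b) (suc i)) (ℕₚ.+-suc j j)) ([x²-t²]^-odd n b j)

  [x²-t²]^-leading : ∀ n → [x²-t²]^ n (n ℕ.+ n) 0 ≡ + 1
  [x²-t²]^-leading zero = refl
  [x²-t²]^-leading (suc n) rewrite ℕₚ.+-suc n n | [x²-t²]^-leading n = refl

  [x²-t²]^-trailing : ∀ n → [x²-t²]^ n 0 (n ℕ.+ n) ≡ -1ℤ ℤ.^ n
  [x²-t²]^-trailing zero = refl
  [x²-t²]^-trailing (suc n) rewrite ℕₚ.+-suc n n | [x²-t²]^-trailing n =
    trans (ℤₚ.+-identityˡ _) (sym (ℤₚ.-1*i≡-i _))

  [x²-t²]^-subleading : ∀ n → [x²-t²]^ (suc n) (n ℕ.+ n) 2 ≡ ℤ.- + suc n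
  [x²-t²]^-subleading zero = refl
  [x²-t²]^-subleading (suc n) rewrite ℕₚ.+-suc n n | [x²-t²]^-subleading n | [x²-t²]^-leading n =
    cong (λ i → ℤ.-[1+ suc i ]) (ℕₚ.+-identityʳ n)

  bCoeff : ℕ → ℕ → ℤ
  bCoeff A k = P₁.convolution (λ a → [x-1]^ (2 ℕ.* A) a 0) (λ b → [x²-t²]^ A b k) (2 ℕ.* A)

  Bcoeff≡bCoeff : ∀ p k → Bcoeff p k ≡ bCoeff (Aₚ p) k
  Bcoeff≡bCoeff p k = begin
    Bcoeff p k
      ≡⟨ SpecialiseCoeffs.coeff-map-homo (bProduct A N) N .P₁.at k ⟨
    coeff₂ (map specialise (bProduct A N)) N k
      ≡⟨ coeff₂-cong (specialise-bProduct A N) N k ⟩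
    coeff₂ ((x - 1#) ^ N * (x * x - t * t) ^ A) N k
      ≡⟨ P₂.coeff-pmul ((x - 1#) ^ N) ((x * x - t * t) ^ A) N .P₁.at k ⟩
    O1.coeff (P₂.convolution (O2.coeff ((x - 1#) ^ N)) (O2.coeff ((x * x - t * t) ^ A)) N) k
      ≡⟨ Polynomial².coeff-convolution-constantˡ ℤ-ring _ _ N k
           (λ a j → trans (coeff₂-[x-1]^ N a (suc j)) ([x-1]^-t-free N a j)) ⟩
    P₁.convolution (λ a → coeff₂ ((x - 1#) ^ N) a 0) (λ b → coeff₂ ((x * x - t * t) ^ A) b k) N
      ≡⟨ P₁.convolution-cong (λ a → coeff₂-[x-1]^ N a 0) (λ b → coeff₂-[x²-t²]^ A b k) N ⟩
    bCoeff A k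
      ∎
    where
    A N : ℕ
    A = Aₚ p
    N = 2 ℕ.* A

2*n≡n+n : ∀ n → 2 ℕ.* n ≡ n ℕ.+ n
2*n≡n+n n = cong (n ℕ.+_) (ℕₚ.+-identityʳ n)

-1^even : ∀ n → -1ℤ ℤ.^ (2 ℕ.* n) ≡ + 1
-1^even n = trans (sym (ℤₚ.^-*-assoc -1ℤ 2 n)) (ℤₚ.^-zeroˡ n)

∣-1^n∣≡1 : ∀ n → ℤ.∣ -1ℤ ℤ.^ n ∣ ≡ 1
∣-1^n∣≡1 zero = refl
∣-1^n∣≡1 (suc n) = trans (cong ℤ.∣_∣ (ℤₚ.-1*i≡-i (-1ℤ ℤ.^ n))) (trans (ℤₚ.∣-i∣≡∣i∣ (-1ℤ ℤ.^ n)) (∣-1^n∣≡1 n))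

bCoeff-odd : ∀ A j → bCoeff A (1 ℕ.+ 2 ℕ.* j) ≡ + 0
bCoeff-odd A j rewrite ℕₚ.+-identityʳ j =
  P₁.convolution-vanishes _ _ (2 ℕ.* A) (λ b _ → [x²-t²]^-odd A b j)

bCoeff-above : ∀ A k → 2 ℕ.* A < k → bCoeff A k ≡ + 0
bCoeff-above A k 2A<k = P₁.convolution-vanishes _ _ (2 ℕ.* A)
  (λ b _ → [x²-t²]^-homogeneous A b k λ b+k≡A+A →
    ℕₚ.<⇒≱ 2A<k (ℕₚ.≤-trans (ℕₚ.m≤n+m k b) (ℕₚ.≤-reflexive (trans b+k≡A+A (sym (2*n≡n+n A))))))

bCoeff-factor : ∀ A k → k ≤ 2 ℕ.* A → bCoeff A k ≡ [x-1]^ (2 ℕ.* A) k 0 ℤ.* [x²-t²]^ A (2 ℕ.* A ∸ k) k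
bCoeff-factor A k k≤2A =
  trans (cong (P₁.convolution _ _) (sym (ℕₚ.m+[n∸m]≡n k≤2A)))
        (P₁.convolution-single k _ _ (2 ℕ.* A ∸ k) λ b b≢2A-k →
          [x²-t²]^-homogeneous A b k λ b+k≡A+A →
            b≢2A-k (trans (sym (ℕₚ.m+n∸n≡m b k)) (cong (_∸ k) (trans b+k≡A+A (sym (2*n≡n+n A))))))

bCoeff-top : ∀ A → bCoeff A (2 ℕ.* A) ≡ -1ℤ ℤ.^ A
bCoeff-top A = begin
  bCoeff A (2 ℕ.* A)
    ≡⟨ bCoeff-factor A (2 ℕ.* A) ℕₚ.≤-refl ⟩
  [x-1]^ (2 ℕ.* A) (2 ℕ.* A) 0 ℤ.* [x²-t²]^ A (2 ℕ.* A ∸ 2 ℕ.* A) (2 ℕ.* A)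
    ≡⟨ cong₂ ℤ._*_ ([x-1]^-leading (2 ℕ.* A))
         (trans (cong₂ ([x²-t²]^ A) (ℕₚ.n∸n≡0 (2 ℕ.* A)) (2*n≡n+n A)) ([x²-t²]^-trailing A)) ⟩
  + 1 ℤ.* -1ℤ ℤ.^ A
    ≡⟨ ℤₚ.*-identityˡ _ ⟩
  -1ℤ ℤ.^ A
    ∎
  where open ≡-Reasoning

bCoeff-constant : ∀ A → bCoeff A 0 ≡ + 1
bCoeff-constant A = begin
  bCoeff A 0
    ≡⟨ bCoeff-factor A 0 ℕ.z≤n ⟩
  [x-1]^ (2 ℕ.* A) 0 0 ℤ.* [x²-t²]^ A (2 ℕ.* A) 0
    ≡⟨ cong₂ ℤ._*_ (trans ([x-1]^-constant (2 ℕ.* A)) (-1^even A))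
                   (trans (cong (λ b → [x²-t²]^ A b 0) (2*n≡n+n A)) ([x²-t²]^-leading A)) ⟩
  + 1
    ∎
  where open ≡-Reasoning

bCoeff-two : ∀ A → 1 ≤ A → bCoeff A 2 ≡ ℤ.- (+ A ℤ.* + A ℤ.* (+ 2 ℤ.* + A ℤ.- + 1))
bCoeff-two A@(suc a) _ = begin
  bCoeff A 2
    ≡⟨ bCoeff-factor A 2 (ℕₚ.*-monoʳ-≤ 2 (ℕ.s≤s ℕ.z≤n)) ⟩
  [x-1]^ N 2 0 ℤ.* [x²-t²]^ A (N ∸ 2) 2
    ≡⟨ cong₂ ℤ._*_ quadratic (trans (cong (λ b → [x²-t²]^ A b 2) N∸2≡a+a) ([x²-t²]^-subleading a)) ⟩
  (+ A ℤ.* (+ 2 ℤ.* + A ℤ.- + 1)) ℤ.* ℤ.- + A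
    ≡⟨ rearrange (+ A) ⟩
  ℤ.- (+ A ℤ.* + A ℤ.* (+ 2 ℤ.* + A ℤ.- + 1))
    ∎
  where
  open ≡-Reasoning
  N = 2 ℕ.* A
  N∸2≡a+a : N ∸ 2 ≡ a ℕ.+ a
  N∸2≡a+a = trans (cong (_∸ 2) (ℕₚ.*-suc 2 a)) (2*n≡n+n a)
  quadratic : [x-1]^ N 2 0 ≡ + A ℤ.* (+ 2 ℤ.* + A ℤ.- + 1)
  quadratic = ℤₚ.*-cancelˡ-≡ (+ 2) _ _ (begin
    + 2 ℤ.* [x-1]^ N 2 0                               ≡⟨ [x-1]^-quadratic N ⟩
    -1ℤ ℤ.^ N ℤ.* (+ N ℤ.* (+ N ℤ.- + 1))               ≡⟨ cong₂ (λ s n → s ℤ.* (n ℤ.* (n ℤ.- + 1))) (-1^even A) (ℤₚ.pos-* 2 A) ⟩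
    + 1 ℤ.* ((+ 2 ℤ.* + A) ℤ.* ((+ 2 ℤ.* + A) ℤ.- + 1))  ≡⟨ halve (+ A) ⟩
    + 2 ℤ.* (+ A ℤ.* (+ 2 ℤ.* + A ℤ.- + 1))             ∎)
    where
    halve : ∀ a → + 1 ℤ.* ((+ 2 ℤ.* a) ℤ.* ((+ 2 ℤ.* a) ℤ.- + 1)) ≡ + 2 ℤ.* (a ℤ.* (+ 2 ℤ.* a ℤ.- + 1))
    halve = solve-∀
  rearrange : ∀ a → (a ℤ.* (+ 2 ℤ.* a ℤ.- + 1)) ℤ.* ℤ.- a ≡ ℤ.- (a ℤ.* a ℤ.* (+ 2 ℤ.* a ℤ.- + 1))
  rearrange = solve-∀

-- Odd primes and congruences

even⊎odd : ∀ n → (∃[ m ] n ≡ 2 ℕ.* m) ⊎ (∃[ m ] n ≡ 1 ℕ.+ 2 ℕ.* m)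
even⊎odd zero = inj₁ (0 , refl)
even⊎odd (suc zero) = inj₂ (0 , refl)
even⊎odd (suc (suc n)) with even⊎odd n
... | inj₁ (m , refl) = inj₁ (suc m , sym (ℕₚ.*-suc 2 m))
... | inj₂ (m , refl) = inj₂ (suc m , cong suc (sym (ℕₚ.*-suc 2 m)))

odd-prime : ∀ {p} → Prime p → p ≢ 2 → ∃[ M ] 1 ≤ M × p ≡ 1 ℕ.+ 2 ℕ.* M
odd-prime {p} p-prime p≢2 with even⊎odd p
... | inj₂ (suc m , p≡1+2M) = suc m , ℕ.s≤s ℕ.z≤n , p≡1+2M
... | inj₂ (zero , refl) = ⊥-elim (¬prime[1] p-prime)
... | inj₁ (m , p≡2m) with prime⇒irreducible p-prime (divides m (trans p≡2m (ℕₚ.*-comm 2 m)))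
...   | inj₁ ()
...   | inj₂ 2≡p = ⊥-elim (p≢2 (sym 2≡p))

p²-1≡4A : ∀ M → (1 ℕ.+ 2 ℕ.* M) ℕ.* (1 ℕ.+ 2 ℕ.* M) ∸ 1 ≡ M ℕ.* (1 ℕ.+ M) ℕ.* 4
p²-1≡4A M = expand M
  where
  expand : ∀ M → 2 ℕ.* M ℕ.+ 2 ℕ.* M ℕ.* (1 ℕ.+ 2 ℕ.* M) ≡ M ℕ.* (1 ℕ.+ M) ℕ.* 4
  expand = NS.solve-∀

Aₚ-odd : ∀ M → Aₚ (1 ℕ.+ 2 ℕ.* M) ≡ M ℕ.* (1 ℕ.+ M)
Aₚ-odd M = trans (cong (_/ 4) (p²-1≡4A M)) (m*n/n≡m (M ℕ.* (1 ℕ.+ M)) 4)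

[p²-1]/2≡2A : ∀ M → let p = 1 ℕ.+ 2 ℕ.* M in (p ℕ.* p ∸ 1) / 2 ≡ 2 ℕ.* Aₚ p
[p²-1]/2≡2A M = begin
  (p ℕ.* p ∸ 1) / 2            ≡⟨ cong (_/ 2) (trans (p²-1≡4A M) (regroup (M ℕ.* (1 ℕ.+ M)))) ⟩
  (2 ℕ.* A) ℕ.* 2 / 2          ≡⟨ m*n/n≡m (2 ℕ.* A) 2 ⟩
  2 ℕ.* A                      ≡⟨ cong (2 ℕ.*_) (Aₚ-odd M) ⟨
  2 ℕ.* Aₚ p                   ∎
  where
  open ≡-Reasoning
  p A : ℕ
  p = 1 ℕ.+ 2 ℕ.* M
  A = M ℕ.* (1 ℕ.+ M)
  regroup : ∀ a → a ℕ.* 4 ≡ (2 ℕ.* a) ℕ.* 2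
  regroup = NS.solve-∀

≡[mod]-by-multiple : ∀ {a b} y p → a ℤ.- b ≡ y ℤ.* + p → a ≡ b [mod p ]
≡[mod]-by-multiple y p a-b≡yp = divides ℤ.∣ y ∣ (trans (cong ℤ.∣_∣ a-b≡yp) (ℤₚ.abs-* y (+ p)))

≡0⇒≡0[mod] : ∀ {a p} → a ≡ + 0 → a ≡ + 0 [mod p ]
≡0⇒≡0[mod] refl = divides 0 refl

unit⇒≢0[mod] : ∀ {p} a → Prime p → ℤ.∣ a ∣ ≡ 1 → ¬ (a ≡ + 0 [mod p ])
unit⇒≢0[mod] a p-prime ∣a∣≡1 p∣a rewrite ℤₚ.+-identityʳ a | ∣a∣≡1 | ∣1⇒≡1 p∣a = ¬prime[1] p-prime

32·t²-coeff≡3 : ∀ M → let a = + (M ℕ.* (1 ℕ.+ M)) in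
  + 32 ℤ.* ℤ.- (a ℤ.* a ℤ.* (+ 2 ℤ.* a ℤ.- + 1)) ≡ + 3 [mod 1 ℕ.+ 2 ℕ.* M ]
32·t²-coeff≡3 M = ≡[mod]-by-multiple {a = + 32 ℤ.* ℤ.- (a ℤ.* a ℤ.* (+ 2 ℤ.* a ℤ.- + 1))} Y (1 ℕ.+ 2 ℕ.* M) (begin
  + 32 ℤ.* ℤ.- (a ℤ.* a ℤ.* (+ 2 ℤ.* a ℤ.- + 1)) ℤ.- + 3
    ≡⟨ cong (λ z → + 32 ℤ.* ℤ.- (z ℤ.* z ℤ.* (+ 2 ℤ.* z ℤ.- + 1)) ℤ.- + 3)
         (trans (ℤₚ.pos-* M (1 ℕ.+ M)) (cong (+ M ℤ.*_) (ℤₚ.pos-+ 1 M))) ⟩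
  + 32 ℤ.* ℤ.- (m[1+m] ℤ.* m[1+m] ℤ.* (+ 2 ℤ.* m[1+m] ℤ.- + 1)) ℤ.- + 3
    ≡⟨ identity (+ M) ⟩
  Y ℤ.* q
    ≡⟨ cong (Y ℤ.*_) (trans (ℤₚ.pos-+ 1 (2 ℕ.* M)) (cong (ℤ._+_ (+ 1)) (ℤₚ.pos-* 2 M))) ⟨
  Y ℤ.* + (1 ℕ.+ 2 ℕ.* M)
    ∎)
  where
  open ≡-Reasoning
  a m[1+m] : ℤ
  a = + (M ℕ.* (1 ℕ.+ M))
  m[1+m] = + M ℤ.* (+ 1 ℤ.+ + M)
  q Y : ℤ
  q = + 1 ℤ.+ + 2 ℤ.* + M
  Y = ℤ.- (q ℤ.* q ℤ.* q ℤ.* q ℤ.* q) ℤ.+ + 5 ℤ.* (q ℤ.* q ℤ.* q) ℤ.- + 7 ℤ.* q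
  identity : ∀ m → + 32 ℤ.* ℤ.- ((m ℤ.* (+ 1 ℤ.+ m)) ℤ.* (m ℤ.* (+ 1 ℤ.+ m)) ℤ.* (+ 2 ℤ.* (m ℤ.* (+ 1 ℤ.+ m)) ℤ.- + 1)) ℤ.- + 3 ≡
    (ℤ.- ((+ 1 ℤ.+ + 2 ℤ.* m) ℤ.* (+ 1 ℤ.+ + 2 ℤ.* m) ℤ.* (+ 1 ℤ.+ + 2 ℤ.* m) ℤ.* (+ 1 ℤ.+ + 2 ℤ.* m) ℤ.* (+ 1 ℤ.+ + 2 ℤ.* m))
      ℤ.+ + 5 ℤ.* ((+ 1 ℤ.+ + 2 ℤ.* m) ℤ.* (+ 1 ℤ.+ + 2 ℤ.* m) ℤ.* (+ 1 ℤ.+ + 2 ℤ.* m)) ℤ.- + 7 ℤ.* (+ 1 ℤ.+ + 2 ℤ.* m))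
    ℤ.* (+ 1 ℤ.+ + 2 ℤ.* m)
  identity = solve-∀

lemma3p9 : (p : ℕ) → Prime p → p ≢ 2 →
    (∀ k → Bcoeff p (1 ℕ.+ 2 ℕ.* k) ≡ + 0 [mod p ])
    × ¬ (Bcoeff p ((p ℕ.* p ∸ 1) / 2) ≡ + 0 [mod p ])
    × (∀ k → (p ℕ.* p ∸ 1) / 2 < k → Bcoeff p k ≡ + 0 [mod p ])
    × ¬ (Bcoeff p 0 ≡ + 0 [mod p ])
    × (+ 32 ℤ.* Bcoeff p 2 ≡ + 3 [mod p ])
lemma3p9 p p-prime p≢2 with odd-prime p-prime p≢2
... | M , 1≤M , refl = odd , top , above , constant , quadratic
  where
  odd : ∀ k → Bcoeff p (1 ℕ.+ 2 ℕ.* k) ≡ + 0 [mod p ]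
  odd k = ≡0⇒≡0[mod] (trans (Bcoeff≡bCoeff p _) (bCoeff-odd (Aₚ p) k))

  top : ¬ (Bcoeff p ((p ℕ.* p ∸ 1) / 2) ≡ + 0 [mod p ])
  top rewrite [p²-1]/2≡2A M = unit⇒≢0[mod] (Bcoeff p (2 ℕ.* Aₚ p)) p-prime
    (trans (cong ℤ.∣_∣ (trans (Bcoeff≡bCoeff p _) (bCoeff-top (Aₚ p)))) (∣-1^n∣≡1 (Aₚ p)))

  above : ∀ k → (p ℕ.* p ∸ 1) / 2 < k → Bcoeff p k ≡ + 0 [mod p ]
  above k 2A<k rewrite [p²-1]/2≡2A M =
    ≡0⇒≡0[mod] (trans (Bcoeff≡bCoeff p k) (bCoeff-above (Aₚ p) k 2A<k))

  constant : ¬ (Bcoeff p 0 ≡ + 0 [mod p ])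
  constant = unit⇒≢0[mod] (Bcoeff p 0) p-prime (cong ℤ.∣_∣ (trans (Bcoeff≡bCoeff p 0) (bCoeff-constant (Aₚ p))))

  quadratic : + 32 ℤ.* Bcoeff p 2 ≡ + 3 [mod p ]
  quadratic rewrite Bcoeff≡bCoeff p 2 | Aₚ-odd M
                  | bCoeff-two (M ℕ.* (1 ℕ.+ M)) (ℕₚ.*-mono-≤ 1≤M (ℕ.s≤s ℕ.z≤n)) = 32·t²-coeff≡3 M
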